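{- Let $\mathbf A=\langle A,\wedge,\vee,\cdot,\to,0,1\rangle$ be an FL${}_{\mathrm e}$-algebra. The following are equivalent: (1) $(\mathbf A,\to)$ is proto-connexive; (2) $\mathbf A$ satisfies $1\leq \neg(x\to\neg x)$ for all $x\in A$; (3) $0$ is the greatest element of $\mathbf A$.
   Context: An FL${}_{\mathrm e}$-algebra is an algebra $\langle A,\wedge,\vee,\cdot,\to,0,1\rangle$ such that $\langle A,\wedge,\vee\rangle$ is a lattice (with order $\leq$), $\langle A,\cdot,1\rangle$ is a commutative monoid, $0$ is an arbitrary constant, and $x\cdot y\leq z \iff x\leq y\to z$ for all $x,y,z$. Write $\neg x:=x\to 0$. For a binary operation ${\Rightarrow}$ on $A$, $(\mathbf A,{\Rightarrow})$ is called proto-connexive if for all $x,y\in A$: $1\leq\neg(x{\Rightarrow}\neg x)$, $1\leq\neg(\neg x{\Rightarrow} x)$, $1\leq (x{\Rightarrow} y){\Rightarrow}\neg(x{\Rightarrow}\neg y)$ and $1\leq (x{\Rightarrow}\neg y){\Rightarrow}\neg(x{\Rightarrow} y)$. -}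

module Defs where

open import Level using (Level; suc; _⊔_)
open import Relation.Binary.PropositionalEquality using (_≡_)
open import Algebra.Lattice.Structures using (IsLattice)
open import Algebra.Structures using (IsCommutativeMonoid)
open import Data.Product using (_×_)
open import Function.Bundles using (_⇔_)

record FLe (a : Level) : Set (suc a) where
  infixr 7 _·_
  infixr 6 _∧_
  infixr 5 _∨_
  infixr 4 _⇒_
  infix 3 _≤_
  field
    Carrier : Set a
    _∧_ _∨_ _·_ _⇒_ : Carrier → Carrier → Carrier
    𝟘 𝟙 : Carrier
    isLattice : IsLattice _≡_ _∨_ _∧_
    isCommutativeMonoid : IsCommutativeMonoid _≡_ _·_ 𝟙

  _≤_ : Carrier → Carrier → Set a
  x ≤ y = (x ∧ y) ≡ x

  field
    residuation : ∀ x y z → ((x · y) ≤ z) ⇔ (x ≤ (y ⇒ z))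

  ¬_ : Carrier → Carrier
  ¬ x = x ⇒ 𝟘

module _ {a : Level} (A : FLe a) where
  open FLe A

  ProtoConnexive : (Carrier → Carrier → Carrier) → Set a
  ProtoConnexive _⇛_ =
    (∀ x → 𝟙 ≤ ¬ (x ⇛ (¬ x))) ×
    (∀ x → 𝟙 ≤ ¬ ((¬ x) ⇛ x)) ×
    (∀ x y → 𝟙 ≤ ((x ⇛ y) ⇛ (¬ (x ⇛ (¬ y))))) ×
    (∀ x y → 𝟙 ≤ ((x ⇛ (¬ y)) ⇛ (¬ (x ⇛ y))))

  ZeroGreatest : Set a
  ZeroGreatest = ∀ x → x ≤ 𝟘

{-# OPTIONS --safe #-}
module Submission where

-- If 𝟘 is the top, so is every ¬ y, and each proto-connexive condition reduces
-- by residuation to an inequality with some ¬ y on the right.  Conversely, for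
-- y given put x := ¬ y ∧ 𝟙: then y · x · x ≤ y · ¬ y · 𝟙 ≤ 𝟘, so y ≤ x ⇒ ¬ x,
-- and Aristotle's thesis 𝟙 ≤ ¬ (x ⇒ ¬ x) says exactly x ⇒ ¬ x ≤ 𝟘.

open import Defs
open import Level using (Level)
open import Data.Product using (_×_; _,_; proj₁; proj₂)
open import Function.Base using (_∘_)
open import Function.Bundles using (_⇔_; mk⇔; Equivalence)
open import Relation.Binary.PropositionalEquality using (_≡_; refl; sym; cong; isEquivalence)
open import Relation.Binary.Bundles using (Poset)
open import Relation.Binary.Lattice.Bundles using (MeetSemilattice)
open import Algebra.Lattice.Bundles using (Lattice)
open import Algebra.Structures using (IsCommutativeMonoid)
import Algebra.Lattice.Properties.Lattice as LatticeProperties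
import Relation.Binary.Reasoning.PartialOrder as PosetReasoning

module FLeProperties {a : Level} (A : FLe a) where
  open FLe A
  open IsCommutativeMonoid isCommutativeMonoid using (comm; identityˡ; identityʳ)

  lattice : Lattice a a
  lattice = record { isLattice = isLattice }

  open LatticeProperties lattice using (∧-idem; ∧-orderTheoreticMeetSemilattice)
  open MeetSemilattice ∧-orderTheoreticMeetSemilattice using (infimum)
    renaming (trans to natural-trans; antisym to natural-antisym)

  -- The library's natural order is x ≡ x ∧ y, the symmetric form of _≤_.
  ≤-refl : ∀ {x} → x ≤ x
  ≤-refl {x} = ∧-idem x

  ≤-trans : ∀ {x y z} → x ≤ y → y ≤ z → x ≤ z
  ≤-trans p q = sym (natural-trans (sym p) (sym q))

  x∧y≤x : ∀ x y → x ∧ y ≤ x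
  x∧y≤x x y = sym (proj₁ (infimum x y))

  x∧y≤y : ∀ x y → x ∧ y ≤ y
  x∧y≤y x y = sym (proj₁ (proj₂ (infimum x y)))

  ≤-antisym : ∀ {x y} → x ≤ y → y ≤ x → x ≡ y
  ≤-antisym p q = natural-antisym (sym p) (sym q)

  ≤-poset : Poset a a a
  ≤-poset = record
    { isPartialOrder = record
      { isPreorder = record
        { isEquivalence = isEquivalence
        ; reflexive = λ { refl → ≤-refl }
        ; trans = ≤-trans
        }
      ; antisym = ≤-antisym
      }
    }

  open PosetReasoning ≤-poset

  curry : ∀ {x y z} → x · y ≤ z → x ≤ y ⇒ z
  curry {x} {y} {z} = Equivalence.to (residuation x y z)

  uncurry : ∀ {x y z} → x ≤ y ⇒ z → x · y ≤ z
  uncurry {x} {y} {z} = Equivalence.from (residuation x y z)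

  modus-ponens : ∀ {x y} → (x ⇒ y) · x ≤ y
  modus-ponens = uncurry ≤-refl

  ·-monoˡ-≤ : ∀ {x y} z → x ≤ y → x · z ≤ y · z
  ·-monoˡ-≤ z x≤y = uncurry (≤-trans x≤y (curry ≤-refl))

  ·-monoʳ-≤ : ∀ z {x y} → x ≤ y → z · x ≤ z · y
  ·-monoʳ-≤ z {x} {y} x≤y = begin
    z · x ≡⟨ comm z x ⟩
    x · z ≤⟨ ·-monoˡ-≤ z x≤y ⟩
    y · z ≡⟨ comm y z ⟩
    z · y ∎

  𝟙≤⇒⇔≤ : ∀ {x y} → (𝟙 ≤ x ⇒ y) ⇔ (x ≤ y)
  𝟙≤⇒⇔≤ {x} {y} = mk⇔
    (λ 𝟙≤x⇒y → begin
      x     ≡⟨ identityˡ x ⟨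
      𝟙 · x ≤⟨ uncurry 𝟙≤x⇒y ⟩
      y     ∎)
    (λ x≤y → curry (begin
      𝟙 · x ≡⟨ identityˡ x ⟩
      x     ≤⟨ x≤y ⟩
      y     ∎))

  AristotlesThesis : Set a
  AristotlesThesis = ∀ x → 𝟙 ≤ ¬ (x ⇒ ¬ x)

  zeroGreatest⇒¬-greatest : ZeroGreatest A → ∀ x y → x ≤ ¬ y
  zeroGreatest⇒¬-greatest 𝟘-greatest x y = curry (𝟘-greatest (x · y))

  zeroGreatest⇒protoConnexive : ZeroGreatest A → ProtoConnexive A _⇒_
  zeroGreatest⇒protoConnexive 𝟘-greatest =
    (λ _ → ¬-greatest 𝟙 _) ,
    (λ _ → ¬-greatest 𝟙 _) ,
    (λ _ _ → Equivalence.from 𝟙≤⇒⇔≤ (¬-greatest _ _)) ,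
    (λ _ _ → Equivalence.from 𝟙≤⇒⇔≤ (¬-greatest _ _))
    where ¬-greatest = zeroGreatest⇒¬-greatest 𝟘-greatest

  aristotlesThesis⇒zeroGreatest : AristotlesThesis → ZeroGreatest A
  aristotlesThesis⇒zeroGreatest thesis y = begin
    y       ≤⟨ curry (curry yxx≤𝟘) ⟩
    x ⇒ ¬ x ≤⟨ Equivalence.to 𝟙≤⇒⇔≤ (thesis x) ⟩
    𝟘       ∎
    where
      x = ¬ y ∧ 𝟙
      yxx≤𝟘 : (y · x) · x ≤ 𝟘
      yxx≤𝟘 = begin
        (y · x) · x   ≤⟨ ·-monoˡ-≤ x (·-monoʳ-≤ y (x∧y≤x (¬ y) 𝟙)) ⟩
        (y · ¬ y) · x ≡⟨ cong (_· x) (comm y (¬ y)) ⟩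
        (¬ y · y) · x ≤⟨ ·-monoˡ-≤ x modus-ponens ⟩
        𝟘 · x         ≤⟨ ·-monoʳ-≤ 𝟘 (x∧y≤y (¬ y) 𝟙) ⟩
        𝟘 · 𝟙         ≡⟨ identityʳ 𝟘 ⟩
        𝟘             ∎

proposition3p3 : ∀ {a : Level} (A : FLe a) →
    let open FLe A in
    (ProtoConnexive A _⇒_ ⇔ (∀ x → 𝟙 ≤ ¬ (x ⇒ (¬ x)))) ×
    ((∀ x → 𝟙 ≤ ¬ (x ⇒ (¬ x))) ⇔ ZeroGreatest A)
proposition3p3 A =
  mk⇔ proj₁ (zeroGreatest⇒protoConnexive ∘ aristotlesThesis⇒zeroGreatest) ,
  mk⇔ aristotlesThesis⇒zeroGreatest (proj₁ ∘ zeroGreatest⇒protoConnexive)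
  where open FLeProperties A
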